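{- Suppose $f<n$. Any $f$-FDO with finite stretch that can be queried also for non-edges must take $\Omega(fn)$ bits of space on graphs with $n$ vertices.
   Context: For a graph $G=(V,E)$ and a set $F$ of unordered vertex pairs (edges or non-edges), $G-F$ denotes $G$ with all edges of $F$ removed. $\mathrm{diam}(H)$ is the maximum shortest-path distance over pairs of vertices of $H$, $+\infty$ if $H$ is disconnected. An $f$-edge fault-tolerant diameter oracle ($f$-FDO) for $G$ is a data structure that, queried with a set $F$ with $|F|\le f$, returns a value $\widehat D$; it has stretch $\sigma\ge1$ if always $\mathrm{diam}(G-F)\le\widehat D\le\sigma\,\mathrm{diam}(G-F)$. Finite stretch means some finite $\sigma$ works. -}

module Defs where

open import Data.Nat using (ℕ; zero; suc; _+_; _*_; _≤_)
open import Data.Fin using (Fin)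
open import Data.Bool using (Bool; true)
open import Data.List using (List; length)
open import Data.List.Membership.Propositional using (_∈_)
open import Data.Maybe using (Maybe; just; nothing)
open import Data.Product using (_×_; _,_; ∃-syntax)
open import Relation.Binary.PropositionalEquality using (_≡_)
open import Relation.Nullary using (¬_)

record Graph (n : ℕ) : Set where
  field
    adj    : Fin n → Fin n → Bool
    sym    : ∀ u v → adj u v ≡ adj v u
    irrefl : ∀ u → ¬ (adj u u ≡ true)
open Graph public

-- A set of unordered vertex pairs (edges or non-edges), given as a list
-- of pairs; the pair (u , v) stands for the unordered pair {u, v}.
FaultSet : ℕ → Set
FaultSet n = List (Fin n × Fin n)

EdgeMinus : ∀ {n} → Graph n → FaultSet n → Fin n → Fin n → Set
EdgeMinus G F u v = (adj G u v ≡ true) × ¬ ((u , v) ∈ F) × ¬ ((v , u) ∈ F)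

data Walk {n : ℕ} (G : Graph n) (F : FaultSet n) : Fin n → Fin n → ℕ → Set where
  here : ∀ {u} → Walk G F u u zero
  step : ∀ {u v w k} → EdgeMinus G F u v → Walk G F v w k → Walk G F u w (suc k)

DistLe : ∀ {n} → Graph n → FaultSet n → Fin n → Fin n → ℕ → Set
DistLe G F u v d = ∃[ k ] (k ≤ d × Walk G F u v k)

DiamLe : ∀ {n} → Graph n → FaultSet n → ℕ → Set
DiamLe G F d = ∀ u v → DistLe G F u v d

-- Extended naturals ℕ ∪ {+∞}: nothing = +∞.
ℕ∞ : Set
ℕ∞ = Maybe ℕ

DiamLe∞ : ∀ {n} → Graph n → FaultSet n → ℕ∞ → Set
DiamLe∞ G F (just d) = DiamLe G F d
DiamLe∞ G F nothing  = Data.Unit.⊤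
  where import Data.Unit

-- D̂ ≤ σ · diam(G - F)   (with σ · ∞ = ∞): whenever diam(G-F) ≤ d is finite,
-- D̂ is finite and D̂ ≤ σ·d.  Since diam(G-F) is the least such d, this is
-- exactly D̂ ≤ σ · diam(G-F).
StretchLe : ∀ {n} → ℕ → Graph n → FaultSet n → ℕ∞ → Set
StretchLe σ G F D̂ = ∀ d → DiamLe G F d → ∃[ e ] ((D̂ ≡ just e) × (e ≤ σ * d))

-- A data structure for graphs on n vertices: the preprocessing maps a graph
-- to a bit string (its stored representation), and queries are answered
-- from that bit string alone.  Faults may be arbitrary vertex pairs
-- (edges or non-edges).
record Oracle (n : ℕ) : Set where
  field
    encode : Graph n → List Bool
    query  : List Bool → FaultSet n → ℕ∞
open Oracle public

IsFDO : ∀ {n} → ℕ → ℕ → Oracle n → Set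
IsFDO {n} f σ O =
  (1 ≤ σ) ×
  (∀ (G : Graph n) (F : FaultSet n) → length F ≤ f →
     DiamLe∞ G F (query O (encode O G) F) × StretchLe σ G F (query O (encode O G) F))

-- An oracle with finite stretch must tell a connected G - F from a disconnected
-- one.  Take a hub joined to every vertex, h "left" and s "right" vertices, and
-- let an arbitrary s × h bit matrix x decide the left–right edges.  Cutting the
-- h pairs joining right vertex β to the hub and to every left vertex except γ
-- (edges or not) leaves the graph connected, of diameter at most 4, iff x β γ = 1.
-- So the encodings of these 2^(sh) graphs are pairwise distinct and one of them
-- has at least sh bits; h ≈ f/2 and s ≈ n - f/2 give sh = Ω(fn).
module Submission where

open import Defs hiding (sym)
open import Data.Bool using (Bool; true; false)
open import Data.Empty using (⊥-elim)
open import Data.Fin using (Fin; zero; suc; fromℕ<; _↑ˡ_; _↑ʳ_; splitAt; combine; remQuot;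
  finToFun; funToFin; _≟_)
open import Data.Fin.Properties
  using (2↔Bool; splitAt-↑ˡ; splitAt-↑ʳ; splitAt⁻¹-↑ˡ; splitAt⁻¹-↑ʳ; combine-remQuot; funToFin-finToFin;
    injective⇒≤; fromℕ<-injective; any?)
open import Data.List using (List; []; _∷_; length; map; allFin)
open import Data.List.Properties using (length-map; length-tabulate)
open import Data.List.Membership.Propositional using (_∈_; _∉_)
open import Data.List.Membership.Propositional.Properties using (∈-map⁺; ∈-map⁻; ∈-allFin)
open import Data.Maybe using (just)
open import Data.Nat using (ℕ; zero; suc; _+_; _*_; _^_; _∸_; _≤_; _<_; z≤n; s≤s; pred; _≤?_;
  ⌈_/2⌉; NonZero)
open import Data.Nat.Properties hiding (_≟_)
open import Data.Nat.Tactic.RingSolver using (solve-∀)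
open import Data.Product using (_×_; _,_; proj₁; proj₂; ∃-syntax; ∃₂; uncurry)
open import Data.Sum using (_⊎_; inj₁; inj₂)
open import Function using (_∘_)
open import Function.Bundles using (Injection)
open import Function.Definitions using (Injective)
open import Function.Properties.Inverse using (↔⇒↣)
open import Relation.Binary.PropositionalEquality
  using (_≡_; _≢_; refl; sym; trans; cong; cong₂; subst; _≗_; module ≡-Reasoning)
open import Relation.Nullary using (¬_; yes; no; contradiction)

module _ {n : ℕ} {G : Graph n} {F : FaultSet n} where

  EdgeMinus-sym : ∀ {u v} → EdgeMinus G F u v → EdgeMinus G F v u
  EdgeMinus-sym {u} {v} (uv , uv∉F , vu∉F) = trans (Graph.sym G v u) uv , vu∉F , uv∉F

  Walk-++ : ∀ {u v w k l} → Walk G F u v k → Walk G F v w l → Walk G F u w (k + l)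
  Walk-++ here       q = q
  Walk-++ (step e p) q = step e (Walk-++ p q)

  Walk-reverse : ∀ {u v k} → Walk G F u v k → Walk G F v u k
  Walk-reverse here                 = here
  Walk-reverse {k = suc k} (step e p) =
    subst (Walk G F _ _) (+-comm k 1) (Walk-++ (Walk-reverse p) (step (EdgeMinus-sym e) here))

  DiamLe-fromCentre : ∀ c r → (∀ u → DistLe G F u c r) → DiamLe G F (r + r)
  DiamLe-fromCentre c r near u v with near u | near v
  ... | k , k≤r , p | l , l≤r , q = k + l , +-mono-≤ k≤r l≤r , Walk-++ p (Walk-reverse q)

  Disconnected : Set
  Disconnected = ∀ d → ¬ DiamLe G F d

  isolated⇒disconnected : ∀ {u w} → (∀ v → ¬ EdgeMinus G F u v) → u ≢ w → Disconnected
  isolated⇒disconnected {u} {w} isolated u≢w d diam with diam u w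
  ... | _ , _ , here       = u≢w refl
  ... | _ , _ , step e _   = isolated _ e

-- Finite stretch is all that is used: it makes the answer on G₁ finite, and the
-- same answer on G₂ would then bound its diameter.
encode-separates : ∀ {n f σ d} {O : Oracle n} {G₁ G₂ : Graph n} {F : FaultSet n} →
  IsFDO f σ O → length F ≤ f → DiamLe G₁ F d → Disconnected {G = G₂} {F} →
  encode O G₁ ≢ encode O G₂
encode-separates {d = d} {O} {G₁} {G₂} {F} (_ , fdo) |F|≤f diam₁ disconnected₂ same
  with proj₂ (fdo G₁ F |F|≤f) d diam₁
... | e , answer₁ , _ = disconnected₂ e (subst (DiamLe∞ G₂ F) answer₂ (proj₁ (fdo G₂ F |F|≤f)))
  where
  answer₂ : query O (encode O G₂) F ≡ just e
  answer₂ = trans (cong (λ c → query O c F) (sym same)) answer₁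

emptyGraph : ∀ n → Graph n
emptyGraph n = record { adj = λ _ _ → false ; sym = λ _ _ → refl ; irrefl = λ _ () }

emptyGraph-disconnected : ∀ {n F} → Disconnected {G = emptyGraph (suc (suc n))} {F}
emptyGraph-disconnected = isolated⇒disconnected {u = zero} {w = suc zero} (λ _ ()) (λ ())

-- Bijective base-2 numeration: lists of length < M get the codes 0 … 2^M - 2.
bitsToℕ : List Bool → ℕ
bitsToℕ []          = 0
bitsToℕ (false ∷ l) = suc (2 * bitsToℕ l)
bitsToℕ (true ∷ l)  = 2 * suc (bitsToℕ l)

bitsToℕ-injective : ∀ l m → bitsToℕ l ≡ bitsToℕ m → l ≡ m
bitsToℕ-injective []          []          _ = refl
bitsToℕ-injective (false ∷ l) (false ∷ m) e =
  cong (false ∷_) (bitsToℕ-injective l m (*-cancelˡ-≡ (bitsToℕ l) (bitsToℕ m) 2 (suc-injective e)))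
bitsToℕ-injective (true ∷ l)  (true ∷ m)  e =
  cong (true ∷_) (bitsToℕ-injective l m (suc-injective (*-cancelˡ-≡ (suc (bitsToℕ l)) (suc (bitsToℕ m)) 2 e)))
bitsToℕ-injective (false ∷ l) (true ∷ m)  e = ⊥-elim (even≢odd (suc (bitsToℕ m)) (bitsToℕ l) (sym e))
bitsToℕ-injective (true ∷ l)  (false ∷ m) e = ⊥-elim (even≢odd (suc (bitsToℕ l)) (bitsToℕ m) e)
bitsToℕ-injective []          (false ∷ _) ()
bitsToℕ-injective []          (true ∷ _)  ()
bitsToℕ-injective (false ∷ _) []          ()
bitsToℕ-injective (true ∷ _)  []          ()

bitsToℕ-bound : ∀ l → 2 + bitsToℕ l ≤ 2 ^ suc (length l)
bitsToℕ-bound []      = ≤-refl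
bitsToℕ-bound (b ∷ l) = ≤-trans (cons-bound b) (*-monoʳ-≤ 2 (bitsToℕ-bound l))
  where
  c = bitsToℕ l
  cons-bound : ∀ b → 2 + bitsToℕ (b ∷ l) ≤ 2 * (2 + c)
  cons-bound false = ≤-trans (n≤1+n _) (≤-reflexive (sym (*-distribˡ-+ 2 2 c)))
  cons-bound true  = ≤-reflexive (sym (*-distribˡ-+ 2 1 (suc c)))

injective⇒∃-long-image : ∀ M {g : Fin (2 ^ M) → List Bool} → Injective _≡_ _≡_ g →
  ∃[ i ] (M ≤ length (g i))
injective⇒∃-long-image M {g} g-injective with any? (λ i → M ≤? length (g i))
... | yes long = long
... | no none   = contradiction (injective⇒≤ code-injective) (n≰pred[n] {{m^n≢0 2 M}})
  where
  code< : ∀ i → bitsToℕ (g i) < pred (2 ^ M)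
  code< i with M ≤? length (g i)
  ... | yes long  = contradiction (i , long) none
  ... | no short = suc[m]≤n⇒m≤pred[n]
    (≤-trans (bitsToℕ-bound (g i)) (^-monoʳ-≤ 2 (≰⇒> short)))

  code : Fin (2 ^ M) → Fin (pred (2 ^ M))
  code i = fromℕ< (code< i)

  code-injective : Injective _≡_ _≡_ code
  code-injective e = g-injective (bitsToℕ-injective _ _ (fromℕ<-injective _ _ (code< _) (code< _) e))

  n≰pred[n] : ∀ {K} → .{{_ : NonZero K}} → ¬ (K ≤ pred K)
  n≰pred[n] K≤predK = <-irrefl refl (m≤pred[n]⇒suc[m]≤n K≤predK)

funToFin-cong : ∀ {m k} {x y : Fin m → Fin k} → x ≗ y → funToFin x ≡ funToFin y
funToFin-cong {zero}  _   = refl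
funToFin-cong {suc m} x≗y = cong₂ combine (x≗y zero) (funToFin-cong (x≗y ∘ suc))

finToFun-injective : ∀ {m k} {i j : Fin (k ^ m)} → finToFun {k} {m} i ≗ finToFun j → i ≡ j
finToFun-injective {m} {k} {i} {j} e = begin
  i                               ≡⟨ funToFin-finToFin {m} {k} i ⟨
  funToFin {m} {k} (finToFun i)   ≡⟨ funToFin-cong e ⟩
  funToFin {m} {k} (finToFun j)   ≡⟨ funToFin-finToFin {m} {k} j ⟩
  j                               ∎
  where open ≡-Reasoning

∃-long-image : ∀ M (g : (Fin M → Bool) → List Bool) → (∀ x y → g x ≡ g y → x ≗ y) →
  ∃[ x ] (M ≤ length (g x))
∃-long-image M g g-injective =
  let i , long = injective⇒∃-long-image M {g ∘ bits} bits-injective in bits i , long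
  where
  open Injection (↔⇒↣ 2↔Bool) using (to; injective)
  bits : Fin (2 ^ M) → Fin M → Bool
  bits i = to ∘ finToFun i
  bits-injective : Injective _≡_ _≡_ (g ∘ bits)
  bits-injective {i} {j} e = finToFun-injective {M} {2} {i} {j} (injective ∘ g-injective (bits i) (bits j) e)

module HubGraph (h s : ℕ) where

  data Role : Set where
    hub   : Role
    left  : Fin h → Role
    right : Fin s → Role

  N : ℕ
  N = suc (h + s)

  vertex : Role → Fin N
  vertex hub       = zero
  vertex (left α)  = suc (α ↑ˡ s)
  vertex (right β) = suc (h ↑ʳ β)

  role : Fin N → Role
  role zero    = hub
  role (suc v) with splitAt h v
  ... | inj₁ α = left α
  ... | inj₂ β = right β

  role-vertex : ∀ r → role (vertex r) ≡ r
  role-vertex hub       = refl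
  role-vertex (left α)  rewrite splitAt-↑ˡ h α s = refl
  role-vertex (right β) rewrite splitAt-↑ʳ h s β = refl

  vertex-role : ∀ u → vertex (role u) ≡ u
  vertex-role zero    = refl
  vertex-role (suc v) with splitAt h v in eq
  ... | inj₁ α = cong suc (splitAt⁻¹-↑ˡ eq)
  ... | inj₂ β = cong suc (splitAt⁻¹-↑ʳ eq)

  vertex-injective : ∀ {r t} → vertex r ≡ vertex t → r ≡ t
  vertex-injective {r} {t} e = trans (sym (role-vertex r)) (trans (cong role e) (role-vertex t))

  ∀-role : ∀ {p} {P : Fin N → Set p} → (∀ r → P (vertex r)) → ∀ u → P u
  ∀-role {P = P} Pr u = subst P (vertex-role u) (Pr (role u))

  -- Entry (β , α) of the s × h bit matrix is x (combine β α).
  Bits : Set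
  Bits = Fin (s * h) → Bool

  adjᴿ : Bits → Role → Role → Bool
  adjᴿ x hub       hub       = false
  adjᴿ x hub       _         = true
  adjᴿ x _         hub       = true
  adjᴿ x (left α)  (right β) = x (combine β α)
  adjᴿ x (right β) (left α)  = x (combine β α)
  adjᴿ x _         _         = false

  adjᴿ-sym : ∀ x r t → adjᴿ x r t ≡ adjᴿ x t r
  adjᴿ-sym x hub       hub       = refl
  adjᴿ-sym x hub       (left _)  = refl
  adjᴿ-sym x hub       (right _) = refl
  adjᴿ-sym x (left _)  hub       = refl
  adjᴿ-sym x (left _)  (left _)  = refl
  adjᴿ-sym x (left _)  (right _) = refl
  adjᴿ-sym x (right _) hub       = refl
  adjᴿ-sym x (right _) (left _)  = refl
  adjᴿ-sym x (right _) (right _) = refl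

  adjᴿ-irrefl : ∀ x r → ¬ (adjᴿ x r r ≡ true)
  adjᴿ-irrefl x hub       ()
  adjᴿ-irrefl x (left _)  ()
  adjᴿ-irrefl x (right _) ()

  hubGraph : Bits → Graph N
  hubGraph x = record
    { adj    = λ u v → adjᴿ x (role u) (role v)
    ; sym    = λ u v → adjᴿ-sym x (role u) (role v)
    ; irrefl = λ u → adjᴿ-irrefl x (role u)
    }

  adj-vertex : ∀ x r t → adj (hubGraph x) (vertex r) (vertex t) ≡ adjᴿ x r t
  adj-vertex x r t rewrite role-vertex r | role-vertex t = refl

  edgeMinus : ∀ {x F} r t → adjᴿ x r t ≡ true →
    (vertex r , vertex t) ∉ F → (vertex t , vertex r) ∉ F → EdgeMinus (hubGraph x) F (vertex r) (vertex t)
  edgeMinus {x} r t rt rt∉F tr∉F = trans (adj-vertex x r t) rt , rt∉F , tr∉F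

  hubGraph-diam : ∀ x → DiamLe (hubGraph x) [] 2
  hubGraph-diam x = DiamLe-fromCentre (vertex hub) 1 (∀-role near)
    where
    near : ∀ r → DistLe (hubGraph x) [] (vertex r) (vertex hub) 1
    near hub       = 0 , z≤n , here
    near (left α)  = 1 , ≤-refl , step (edgeMinus (left α) hub refl (λ ()) (λ ())) here
    near (right β) = 1 , ≤-refl , step (edgeMinus (right β) hub refl (λ ()) (λ ())) here

  module Cut (β : Fin s) (γ : Fin h) where

    target : Fin h → Role
    target δ with δ ≟ γ
    ... | yes _ = hub
    ... | no _  = left δ

    cut : FaultSet N
    cut = map (λ δ → vertex (right β) , vertex (target δ)) (allFin h)

    length-cut : length cut ≡ h
    length-cut = trans (length-map _ (allFin h)) (length-tabulate _)

    cut-member : ∀ δ → (vertex (right β) , vertex (target δ)) ∈ cut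
    cut-member δ = ∈-map⁺ _ (∈-allFin δ)

    target≢left-γ : ∀ δ → target δ ≢ left γ
    target≢left-γ δ with δ ≟ γ
    ... | yes _  = λ ()
    ... | no δ≢γ = λ { refl → δ≢γ refl }

    ∈cut⁻ : ∀ {u v} → (u , v) ∈ cut → u ≡ vertex (right β) × v ≢ vertex (left γ)
    ∈cut⁻ uv∈cut with ∈-map⁻ _ uv∈cut
    ... | δ , _ , refl = refl , target≢left-γ δ ∘ vertex-injective

    ∉cut-fromRightβ : ∀ {r v} → r ≢ right β → (vertex r , v) ∉ cut
    ∉cut-fromRightβ r≢β rv∈cut with ∈cut⁻ rv∈cut
    ... | r≡β , _ = r≢β (vertex-injective r≡β)

    ∉cut-toLeftγ : ∀ {u} → (u , vertex (left γ)) ∉ cut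
    ∉cut-toLeftγ uγ∈cut with ∈cut⁻ uγ∈cut
    ... | _ , γ≢γ = γ≢γ refl

    hub∈cut : (vertex (right β) , vertex hub) ∈ cut
    hub∈cut with γ ≟ γ | cut-member γ
    ... | yes _ | ∈c  = ∈c
    ... | no γ≢γ | _ = contradiction refl γ≢γ

    left∈cut : ∀ {δ} → δ ≢ γ → (vertex (right β) , vertex (left δ)) ∈ cut
    left∈cut {δ} δ≢γ with δ ≟ γ | cut-member δ
    ... | yes δ≡γ | _  = contradiction δ≡γ δ≢γ
    ... | no _    | ∈c = ∈c

    cut-disconnects : ∀ x → x (combine β γ) ≡ false → Disconnected {G = hubGraph x} {cut}
    cut-disconnects x xβγ≡0 =
      isolated⇒disconnected {w = vertex hub} (∀-role isolated) (λ ())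
      where
      isolated : ∀ t → ¬ EdgeMinus (hubGraph x) cut (vertex (right β)) (vertex t)
      isolated hub       (_ , ∉c , _) = ∉c hub∈cut
      isolated (right β′) (βt , _)    with () ← trans (sym (adj-vertex x (right β) (right β′))) βt
      isolated (left δ)  (βδ , ∉c , _) with δ ≟ γ
      ... | no δ≢γ = ∉c (left∈cut δ≢γ)
      ... | yes refl with () ← trans (sym xβγ≡0) (trans (sym (adj-vertex x (right β) (left γ))) βδ)

    -- The only vertex whose hub edge is cut is right β, which detours through left γ.
    cut-diam : ∀ x → x (combine β γ) ≡ true → DiamLe (hubGraph x) cut 4
    cut-diam x xβγ≡1 = DiamLe-fromCentre (vertex hub) 2 (∀-role near)
      where
      hub-edge : ∀ r → adjᴿ x r hub ≡ true → r ≢ right β →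
        EdgeMinus (hubGraph x) cut (vertex r) (vertex hub)
      hub-edge r r~hub r≢β = edgeMinus r hub r~hub (∉cut-fromRightβ r≢β) (∉cut-fromRightβ {hub} (λ ()))

      near : ∀ r → DistLe (hubGraph x) cut (vertex r) (vertex hub) 2
      near hub        = 0 , z≤n , here
      near (left α)   = 1 , s≤s z≤n , step (hub-edge (left α) refl (λ ())) here
      near (right β′) with β′ ≟ β
      ... | no β′≢β = 1 , s≤s z≤n , step (hub-edge (right β′) refl (β′≢β ∘ λ { refl → refl })) here
      ... | yes refl = 2 , ≤-refl ,
        step (edgeMinus (right β) (left γ) xβγ≡1 ∉cut-toLeftγ (∉cut-fromRightβ {left γ} (λ ())))
             (step (hub-edge (left γ) refl (λ ())) here)

  module _ {f σ} {O : Oracle N} (fdo : IsFDO f σ O) (h≤f : h ≤ f) where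

    encode-separates-bit : ∀ {β γ} x y → x (combine β γ) ≡ true → y (combine β γ) ≡ false →
      encode O (hubGraph x) ≢ encode O (hubGraph y)
    encode-separates-bit {β} {γ} x y xβγ≡1 yβγ≡0 =
      encode-separates {O = O} fdo (subst (_≤ f) (sym length-cut) h≤f) (cut-diam x xβγ≡1)
        (cut-disconnects y yβγ≡0)
      where open Cut β γ

    encode-hubGraph-injective : ∀ x y → encode O (hubGraph x) ≡ encode O (hubGraph y) → x ≗ y
    encode-hubGraph-injective x y same k =
      subst (λ k → x k ≡ y k) (combine-remQuot {s} h k) (agree (remQuot {s} h k))
      where
      agree : ∀ βγ → x (uncurry (combine {s} {h}) βγ) ≡ y (uncurry combine βγ)
      agree (β , γ) with x (combine β γ) in xβγ | y (combine β γ) in yβγ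
      ... | false | false = refl
      ... | true  | true  = refl
      ... | true  | false = contradiction same (encode-separates-bit x y xβγ yβγ)
      ... | false | true  = contradiction (sym same) (encode-separates-bit y x yβγ xβγ)

    hubGraph-lowerBound : ∃[ G ] (s * h ≤ length (encode O G))
    hubGraph-lowerBound with ∃-long-image (s * h) (encode O ∘ hubGraph) encode-hubGraph-injective
    ... | x , long = hubGraph x , long

≢⇒nonempty : ∀ {A : Set} {l₁ l₂ : List A} → l₁ ≢ l₂ → 1 ≤ length l₁ ⊎ 1 ≤ length l₂
≢⇒nonempty {l₁ = []}    {[]}    l₁≢l₂ = contradiction refl l₁≢l₂
≢⇒nonempty {l₁ = _ ∷ _}         _     = inj₁ (s≤s z≤n)
≢⇒nonempty {l₁ = []}    {_ ∷ _} _     = inj₂ (s≤s z≤n)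

-- A star (no left vertices) against the empty graph, with no faults.
encode-nonempty : ∀ {n f σ} {O : Oracle (suc (suc n))} → IsFDO f σ O →
  ∃[ G ] (1 ≤ length (encode O G))
encode-nonempty {n} {O = O} fdo
  with ≢⇒nonempty (encode-separates {O = O} fdo z≤n (hubGraph-diam star) emptyGraph-disconnected)
  where
  open HubGraph 0 (suc n) using (hubGraph; hubGraph-diam)
  star = λ _ → false
... | inj₁ nonempty = _ , nonempty
... | inj₂ nonempty = _ , nonempty

suc[h+s]≤4s : ∀ {h s} → h ≤ suc s → 2 ≤ h + s → suc (h + s) ≤ 4 * s
suc[h+s]≤4s {h} {zero}  h≤1 2≤h+0 =
  contradiction (≤-trans 2≤h+0 (≤-trans (≤-reflexive (+-identityʳ h)) h≤1)) λ { (s≤s ()) }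
suc[h+s]≤4s {h} {suc s} h≤2+s _ = begin
  suc (h + suc s)                        ≤⟨ s≤s (+-monoˡ-≤ (suc s) h≤2+s) ⟩
  suc (suc (suc s) + suc s)              ≤⟨ m≤m+n _ (s + s) ⟩
  suc (suc (suc s) + suc s) + (s + s)    ≡⟨ normalise s ⟩
  4 * suc s                              ∎
  where
  open ≤-Reasoning
  normalise : ∀ s → suc (suc (suc s) + suc s) + (s + s) ≡ 4 * suc s
  normalise = solve-∀

-- h = ⌈f/2⌉ left vertices: f ≤ 2h, and h ≤ s + 1 forces n ≤ 4s once n ≥ 3.
split-vertices : ∀ {f m} → f ≤ m → 2 ≤ m → ∃₂ λ h s → h + s ≡ m × h ≤ f × f * suc m ≤ 8 * (s * h)
split-vertices {f} {m} f≤m 2≤m = h , s , h+s≡m , ⌈n/2⌉≤n f , fn≤8sh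
  where
  h = ⌈ f /2⌉
  s = m ∸ h

  h+s≡m : h + s ≡ m
  h+s≡m = m+[n∸m]≡n (≤-trans (⌈n/2⌉≤n f) f≤m)

  f≤h+h : f ≤ h + h
  f≤h+h = ≤-trans (≤-reflexive (sym (⌊n/2⌋+⌈n/2⌉≡n f))) (+-monoˡ-≤ h (⌊n/2⌋≤⌈n/2⌉ f))

  h+h≤1+f : h + h ≤ suc f
  h+h≤1+f = ≤-trans (+-monoʳ-≤ h (⌊n/2⌋≤⌈n/2⌉ (suc f))) (≤-reflexive (⌊n/2⌋+⌈n/2⌉≡n (suc f)))

  h≤1+s : h ≤ suc s
  h≤1+s = +-cancelˡ-≤ h h (suc s) (begin
    h + h        ≤⟨ h+h≤1+f ⟩
    suc f        ≤⟨ s≤s f≤m ⟩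
    suc m        ≡⟨ cong suc h+s≡m ⟨
    suc (h + s)  ≡⟨ +-suc h s ⟨
    h + suc s    ∎)
    where open ≤-Reasoning

  fn≤8sh : f * suc m ≤ 8 * (s * h)
  fn≤8sh = begin
    f * suc m              ≤⟨ *-mono-≤ f≤h+h (subst (λ k → suc k ≤ 4 * s) h+s≡m n≤4s) ⟩
    (h + h) * (4 * s)      ≡⟨ normalise h s ⟩
    8 * (s * h)            ∎
    where
    open ≤-Reasoning
    n≤4s = suc[h+s]≤4s h≤1+s (subst (2 ≤_) (sym h+s≡m) 2≤m)
    normalise : ∀ h s → (h + h) * (4 * s) ≡ 8 * (s * h)
    normalise = solve-∀

theorem4 : ∃[ c ] (1 ≤ c × (∀ (n f : ℕ) → f < n → ∀ (σ : ℕ) (O : Oracle n) → IsFDO f σ O →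
             ∃[ G ] (f * n ≤ c * length (encode O G))))
theorem4 = 8 , s≤s z≤n , lowerBound
  where
  large : ∀ {m f σ} → f ≤ m → 2 ≤ m → (O : Oracle (suc m)) → IsFDO f σ O →
    ∃[ G ] (f * suc m ≤ 8 * length (encode O G))
  large f≤m 2≤m O fdo with split-vertices f≤m 2≤m
  ... | h , s , refl , h≤f , fn≤8sh with HubGraph.hubGraph-lowerBound h s {O = O} fdo h≤f
  ...   | G , sh≤|G| = G , ≤-trans fn≤8sh (*-monoʳ-≤ 8 sh≤|G|)

  lowerBound : ∀ n f → f < n → ∀ σ (O : Oracle n) → IsFDO f σ O →
    ∃[ G ] (f * n ≤ 8 * length (encode O G))
  lowerBound n                   zero          _               _ _ _   = emptyGraph n , z≤n
  -- Here ⌈f/2⌉ = 1 leaves no right vertex, so only one bit can be forced.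
  lowerBound 2                   1             _               _ O fdo with encode-nonempty {O = O} fdo
  ... | G , 1≤|G| = G , ≤-trans (s≤s (s≤s z≤n)) (*-monoʳ-≤ 8 1≤|G|)
  lowerBound (suc (suc (suc m))) f             (s≤s f≤m)       _ O fdo = large f≤m (s≤s (s≤s z≤n)) O fdo
  lowerBound 0                   (suc _)       ()
  lowerBound 1                   (suc _)       (s≤s ())
  lowerBound 2                   (suc (suc _)) (s≤s (s≤s ()))
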